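{- Every tree-cograph has NLC-width at most $3$ and clique-width at most $4$.
   Context: Tree-cographs are defined recursively: (1) every tree is a tree-cograph; (2) if $G$ is a tree-cograph, then its edge complement $\overline{G}$ (same vertices, two distinct vertices adjacent iff not adjacent in $G$) is a tree-cograph; (3) if $G_1,\dots,G_k$, $k\ge2$, are connected tree-cographs, then their disjoint union is a tree-cograph. Only graphs obtained this way are tree-cographs. Clique-width: for a positive integer $k$, $\mathrm{CW}_k$ is the smallest class of graphs whose vertices carry labels from $\{1,\dots,k\}$ that contains every single-vertex graph with any label and is closed under: disjoint union; relabeling $\rho_{a\to b}$ for $a\neq b$; and $\eta_{a,b}$ for $a\neq b$ (add all edges between vertices labeled $a$ and vertices labeled $b$). $\operatorname{cw}(G)$ is the least $k$ such that some labeling of $G$ lies in $\mathrm{CW}_k$. NLC-width: $\mathrm{NLC}_k$ is the smallest class of labeled graphs (labels in $\{1,\dots,k\}$) containing every single-vertex graph with any label and closed under: $G\times_S J$ for $S\subseteq\{1,\dots,k\}^2$ (disjoint union of vertex-disjoint $G$ and $J$ plus all edges $\{u,v\}$, $u\in V_G$, $v\in V_J$, $(\mathrm{lab}(u),\mathrm{lab}(v))\in S$); and $\circ_R$ for $R:\{1,\dots,k\}\to\{1,\dots,k\}$. $\operatorname{nlcw}(G)$ is the least $k$ such that some labeling of $G$ lies in $\mathrm{NLC}_k$. -}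

module Defs where

open import Data.Nat using (ℕ; zero; suc; _+_; _≤_)
open import Data.Fin using (Fin; zero; suc; splitAt; inject₁; fromℕ; _≟_)
open import Data.Bool using (Bool; true; false; not; _∨_; _∧_; if_then_else_)
open import Data.Sum using (_⊎_; inj₁; inj₂)
open import Data.Product using (Σ; _×_; _,_)
open import Relation.Nullary using (¬_)
open import Relation.Nullary.Decidable using (⌊_⌋)
open import Relation.Binary.PropositionalEquality using (_≡_; _≢_)
open import Function.Bundles using (_↔_; Inverse)
open import Function.Definitions using (Injective)

record Graph : Set where
  constructor mkGraph
  field
    size : ℕ
    adj  : Fin size → Fin size → Bool
open Graph public

IsSimple : Graph → Set
IsSimple G = (∀ i j → adj G i j ≡ adj G j i) × (∀ i → adj G i i ≡ false)

record _≅_ (G H : Graph) : Set where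
  field
    bij      : Fin (size G) ↔ Fin (size H)
    preserve : ∀ i j → adj G i j ≡ adj H (Inverse.to bij i) (Inverse.to bij j)

data Walk (G : Graph) : Fin (size G) → Fin (size G) → Set where
  here : ∀ {i} → Walk G i i
  step : ∀ {i j k} → adj G i j ≡ true → Walk G j k → Walk G i k

Connected : Graph → Set
Connected G = (1 ≤ size G) × (∀ i j → Walk G i j)

-- a cycle of length p+3: injective map of vertices, consecutive adjacent, closing edge
record Cycle (G : Graph) : Set where
  field
    p     : ℕ
    vs    : Fin (suc (suc (suc p))) → Fin (size G)
    inj   : Injective _≡_ _≡_ vs
    edges : ∀ (i : Fin (suc (suc p))) → adj G (vs (inject₁ i)) (vs (suc i)) ≡ true
    close : adj G (vs (fromℕ (suc (suc p)))) (vs zero) ≡ true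

Acyclic : Graph → Set
Acyclic G = ¬ Cycle G

Tree : Graph → Set
Tree G = IsSimple G × Connected G × Acyclic G

complement : Graph → Graph
complement G = mkGraph (size G) (λ i j → if ⌊ i ≟ j ⌋ then false else not (adj G i j))

_⊕_ : Graph → Graph → Graph
mkGraph m a ⊕ mkGraph n b = mkGraph (m + n) f
  where
  f : Fin (m + n) → Fin (m + n) → Bool
  f i j with splitAt m i | splitAt m j
  ... | inj₁ x | inj₁ y = a x y
  ... | inj₂ x | inj₂ y = b x y
  ... | _      | _      = false

emptyGraph : Graph
emptyGraph = mkGraph 0 (λ ())

bigUnion : (k : ℕ) → (Fin k → Graph) → Graph
bigUnion zero    Gs = emptyGraph
bigUnion (suc k) Gs = Gs zero ⊕ bigUnion k (λ i → Gs (suc i))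

-- Tree-cographs (closed under isomorphism, as any graph class)

data TreeCograph : Graph → Set where
  tree  : ∀ {G} → Tree G → TreeCograph G
  compl : ∀ {G} → TreeCograph G → TreeCograph (complement G)
  union : (k : ℕ) → 2 ≤ k → (Gs : Fin k → Graph) →
          (∀ i → TreeCograph (Gs i)) → (∀ i → Connected (Gs i)) →
          TreeCograph (bigUnion k Gs)
  iso   : ∀ {G H} → TreeCograph G → G ≅ H → TreeCograph H

_==_ : ∀ {k} → Fin k → Fin k → Bool
a == b = ⌊ a ≟ b ⌋

data CWExpr (k : ℕ) : ℕ → Set where
  vert  : Fin k → CWExpr k 1
  union : ∀ {m n} → CWExpr k m → CWExpr k n → CWExpr k (m + n)
  relab : ∀ {n} (a b : Fin k) → a ≢ b → CWExpr k n → CWExpr k n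
  eta   : ∀ {n} (a b : Fin k) → a ≢ b → CWExpr k n → CWExpr k n

cwLabel : ∀ {k n} → CWExpr k n → Fin n → Fin k
cwLabel (vert a) _ = a
cwLabel (union {m} e f) i with splitAt m i
... | inj₁ x = cwLabel e x
... | inj₂ y = cwLabel f y
cwLabel (relab a b _ e) i = if cwLabel e i == a then b else cwLabel e i
cwLabel (eta _ _ _ e) i = cwLabel e i

cwAdj : ∀ {k n} → CWExpr k n → Fin n → Fin n → Bool
cwAdj (vert a) _ _ = false
cwAdj (union {m} e f) i j with splitAt m i | splitAt m j
... | inj₁ x | inj₁ y = cwAdj e x y
... | inj₂ x | inj₂ y = cwAdj f x y
... | _      | _      = false
cwAdj (relab _ _ _ e) i j = cwAdj e i j
cwAdj (eta a b _ e) i j =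
  cwAdj e i j ∨ ((cwLabel e i == a ∧ cwLabel e j == b) ∨ (cwLabel e i == b ∧ cwLabel e j == a))

cwGraph : ∀ {k n} → CWExpr k n → Graph
cwGraph {n = n} e = mkGraph n (cwAdj e)

InCW : ℕ → Graph → Set
InCW k G = Σ ℕ λ n → Σ (CWExpr k n) λ e → cwGraph e ≅ G

CliqueWidthAtMost : ℕ → Graph → Set
CliqueWidthAtMost k G = Σ ℕ λ k′ → (1 ≤ k′) × (k′ ≤ k) × InCW k′ G

data NLCExpr (k : ℕ) : ℕ → Set where
  vert  : Fin k → NLCExpr k 1
  times : ∀ {m n} → (S : Fin k → Fin k → Bool) → NLCExpr k m → NLCExpr k n → NLCExpr k (m + n)
  relab : ∀ {n} → (R : Fin k → Fin k) → NLCExpr k n → NLCExpr k n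

nlcLabel : ∀ {k n} → NLCExpr k n → Fin n → Fin k
nlcLabel (vert a) _ = a
nlcLabel (times {m} S e f) i with splitAt m i
... | inj₁ x = nlcLabel e x
... | inj₂ y = nlcLabel f y
nlcLabel (relab R e) i = R (nlcLabel e i)

nlcAdj : ∀ {k n} → NLCExpr k n → Fin n → Fin n → Bool
nlcAdj (vert a) _ _ = false
nlcAdj (times {m} S e f) i j with splitAt m i | splitAt m j
... | inj₁ x | inj₁ y = nlcAdj e x y
... | inj₂ x | inj₂ y = nlcAdj f x y
... | inj₁ x | inj₂ y = S (nlcLabel e x) (nlcLabel f y)
... | inj₂ y | inj₁ x = S (nlcLabel e x) (nlcLabel f y)
nlcAdj (relab R e) i j = nlcAdj e i j

nlcGraph : ∀ {k n} → NLCExpr k n → Graph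
nlcGraph {n = n} e = mkGraph n (nlcAdj e)

InNLC : ℕ → Graph → Set
InNLC k G = Σ ℕ λ n → Σ (NLCExpr k n) λ e → nlcGraph e ≅ G

NLCWidthAtMost : ℕ → Graph → Set
NLCWidthAtMost k G = Σ ℕ λ k′ → (1 ≤ k′) × (k′ ≤ k) × InNLC k′ G

{-# OPTIONS --safe #-}
-- A forest is assembled from single vertices by repeatedly putting two rooted forests side by
-- side and optionally joining their roots, the first root becoming the root of the result;
-- that every forest arises so follows by removing a vertex of degree at most one (the end of a
-- longest path) and attaching it again.  If every intermediate expression gives its root label 0
-- and all other vertices label 1, one such step costs one more NLC label (to park the second
-- root) and two more clique-width labels (for the second root and the second non-roots), and the
-- same clique-width step also builds the complement, where every pair across the two parts
-- except possibly the two roots is joined.  NLC-width is invariant under complementation (negate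
-- every join relation), and the complement of a disjoint union is the join of the complements,
-- so "NLC-width ≤ 3, and clique-width ≤ 4 for the graph and for its complement" propagates
-- through the rules generating the tree-cographs.
module Submission where

open import Defs
open import Data.Bool using (Bool; true; false; not; _∨_; _∧_; if_then_else_)
open import Data.Bool.Properties using (not-involutive; ∨-identityʳ; ∧-zeroʳ; ¬-not)
import Data.Bool.Properties as Bool
open import Data.Empty using (⊥-elim)
open import Data.Fin using (Fin; zero; suc; splitAt; join; toℕ; inject₁; inject≤; fromℕ; punchIn; punchOut; _≟_)
open import Data.Fin.Patterns using (0F; 1F; 2F; 3F)
open import Data.Fin.Properties
  using (+↔⊎; 1↔⊤; splitAt-join; toℕ-injective; toℕ-inject≤; toℕ-inject₁; toℕ-fromℕ; toℕ<n; inject≤-injective;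
         injective⇒≤; any?; punchIn-injective; punchInᵢ≢i; punchIn-punchOut; punchOut-punchIn; punchOut-cong)
open import Data.Nat using (ℕ; zero; suc; _+_; _≤_; s≤s; z≤n)
open import Data.Nat.Properties using (<-irrefl; ≤-refl; ≤-trans; m≤m+n; +-suc)
open import Data.Product using (Σ; ∃; _×_; _,_)
open import Data.Sum using (_⊎_; inj₁; inj₂; [_,_]; map; map₂)
open import Data.Sum.Algebra using (⊎-cong)
open import Data.Sum.Properties using (≡-dec; [,]-map)
open import Data.Unit using (⊤; tt)
import Data.Unit.Properties as ⊤
open import Function using (_∘_; id)
open import Function.Bundles using (_↔_; Inverse; Injection; mk↔ₛ′)
open import Function.Definitions using (Injective)
open import Function.Properties.Inverse using (↔-refl; ↔-sym; ↔-trans; ↔⇒↣)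
open import Relation.Binary.Definitions using (DecidableEquality)
open import Relation.Binary.PropositionalEquality using (_≡_; _≢_; refl; sym; trans; cong; cong₂; subst; module ≡-Reasoning)
open import Relation.Nullary using (¬_; does; yes; no)
open import Relation.Nullary.Decidable using (⌊_⌋; _×-dec_; ¬?; decidable-stable; dec-true; dec-false)

open Inverse using (to; from; strictlyInverseˡ)

_≗₂_ : ∀ {A B C : Set} → (A → B → C) → (A → B → C) → Set
f ≗₂ g = ∀ x y → f x y ≡ g x y

⌊≟⌋-injective : ∀ {A B : Set} (_≟ᴬ_ : DecidableEquality A) (_≟ᴮ_ : DecidableEquality B) {f : A → B} →
                Injective _≡_ _≡_ f → ∀ x y → ⌊ f x ≟ᴮ f y ⌋ ≡ ⌊ x ≟ᴬ y ⌋
⌊≟⌋-injective _≟ᴬ_ _≟ᴮ_ {f} f-inj x y with x ≟ᴬ y | f x ≟ᴮ f y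
... | yes _    | yes _     = refl
... | no _     | no _      = refl
... | yes refl | no fx≢fx  = ⊥-elim (fx≢fx refl)
... | no x≢y   | yes fx≡fy = ⊥-elim (x≢y (f-inj fx≡fy))

↔-injective : ∀ {A B : Set} (e : A ↔ B) → Injective _≡_ _≡_ (to e)
↔-injective e = Injection.injective (↔⇒↣ e)

coAdj : ∀ {n} → (Fin n → Fin n → Bool) → Fin n → Fin n → Bool
coAdj a i j = if i == j then false else not (a i j)

coAdj-cong : ∀ {n} {a b : Fin n → Fin n → Bool} → a ≗₂ b → coAdj a ≗₂ coAdj b
coAdj-cong a≗b i j = cong (λ c → if i == j then false else not c) (a≗b i j)

Loopless : Graph → Set
Loopless G = ∀ i → adj G i i ≡ false

record _≃_ (G : Graph) {A : Set} (E : A → A → Bool) : Set where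
  field
    vertices  : Fin (size G) ↔ A
    preserves : ∀ i j → adj G i j ≡ E (to vertices i) (to vertices j)
open _≃_

≅⇒≃ : ∀ {G H} → G ≅ H → G ≃ adj H
≅⇒≃ φ = record { vertices = _≅_.bij φ ; preserves = _≅_.preserve φ }

≃⇒≅ : ∀ {G H} → G ≃ adj H → G ≅ H
≃⇒≅ φ = record { bij = vertices φ ; preserve = preserves φ }

≃-trans : ∀ {G} {A B : Set} {E : A → A → Bool} {F : B → B → Bool} → G ≃ E →
          (e : A ↔ B) → (∀ x y → E x y ≡ F (to e x) (to e y)) → G ≃ F
≃-trans φ e E≈F = record
  { vertices  = ↔-trans (vertices φ) e
  ; preserves = λ i j → trans (preserves φ i j) (E≈F _ _) }

≃-unique : ∀ {G H} {A : Set} {E : A → A → Bool} → G ≃ E → H ≃ E → G ≅ H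
≃-unique {G} {H} {A} {E} φ ψ = record
  { bij      = ↔-trans β (↔-sym γ)
  ; preserve = λ i j → begin
      adj G i j                                           ≡⟨ preserves φ i j ⟩
      E (to β i) (to β j)                                 ≡⟨ cong₂ E (strictlyInverseˡ γ _) (strictlyInverseˡ γ _) ⟨
      E (to γ (from γ (to β i))) (to γ (from γ (to β j))) ≡⟨ preserves ψ _ _ ⟨
      adj H (from γ (to β i)) (from γ (to β j))           ∎ }
  where
  open ≡-Reasoning
  β : Fin (size G) ↔ A
  β = vertices φ
  γ : Fin (size H) ↔ A
  γ = vertices ψ

≃-self : (G : Graph) → G ≃ adj G
≃-self G = record { vertices = ↔-refl ; preserves = λ _ _ → refl }

≗⇒≅ : ∀ {n} {a b : Fin n → Fin n → Bool} → a ≗₂ b → mkGraph n a ≅ mkGraph n b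
≗⇒≅ a≗b = record { bij = ↔-refl ; preserve = a≗b }

≅-sym : ∀ {G H} → G ≅ H → H ≅ G
≅-sym {H = H} φ = ≃-unique (≃-self H) (≅⇒≃ φ)

≅-trans : ∀ {G H K} → G ≅ H → H ≅ K → G ≅ K
≅-trans φ ψ = ≃⇒≅ (≃-trans (≅⇒≃ φ) (_≅_.bij ψ) (_≅_.preserve ψ))

≅-loopless : ∀ {G H} → G ≅ H → Loopless G → Loopless H
≅-loopless {G} {H} φ G-loopless i = begin
  adj H i i                                 ≡⟨ cong₂ (adj H) (strictlyInverseˡ β i) (strictlyInverseˡ β i) ⟨
  adj H (to β (from β i)) (to β (from β i)) ≡⟨ _≅_.preserve φ _ _ ⟨
  adj G (from β i) (from β i)               ≡⟨ G-loopless _ ⟩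
  false                                     ∎
  where
  open ≡-Reasoning
  β : Fin (size G) ↔ Fin (size H)
  β = _≅_.bij φ

complement-loopless : ∀ G → Loopless (complement G)
complement-loopless G i with i ≟ i
... | yes _   = refl
... | no i≢i  = ⊥-elim (i≢i refl)

complement-cong : ∀ {G H} → G ≅ H → complement G ≅ complement H
complement-cong {G} {H} φ = record { bij = β ; preserve = co-preserve }
  where
  β : Fin (size G) ↔ Fin (size H)
  β = _≅_.bij φ
  co-preserve : ∀ i j → coAdj (adj G) i j ≡ coAdj (adj H) (to β i) (to β j)
  co-preserve i j rewrite ⌊≟⌋-injective _≟_ _≟_ (↔-injective β) i j | _≅_.preserve φ i j = refl

complement-involutive : ∀ G → Loopless G → complement (complement G) ≅ G
complement-involutive G G-loopless = record { bij = ↔-refl ; preserve = double-complement }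
  where
  double-complement : coAdj (coAdj (adj G)) ≗₂ adj G
  double-complement i j with i ≟ j
  ... | yes refl = sym (G-loopless i)
  ... | no _     = not-involutive (adj G i j)

⊎-adj : ∀ {A B : Set} → (A → B → Bool) → (A → A → Bool) → (B → B → Bool) → A ⊎ B → A ⊎ B → Bool
⊎-adj X a b (inj₁ x) (inj₁ y) = a x y
⊎-adj X a b (inj₁ x) (inj₂ y) = X x y
⊎-adj X a b (inj₂ x) (inj₁ y) = X y x
⊎-adj X a b (inj₂ x) (inj₂ y) = b x y

⊎-adj-cong : ∀ {A B : Set} {X X′ : A → B → Bool} {a a′ : A → A → Bool} {b b′ : B → B → Bool} →
             X ≗₂ X′ → a ≗₂ a′ → b ≗₂ b′ → ⊎-adj X a b ≗₂ ⊎-adj X′ a′ b′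
⊎-adj-cong X≗ a≗ b≗ (inj₁ x) (inj₁ y) = a≗ x y
⊎-adj-cong X≗ a≗ b≗ (inj₁ x) (inj₂ y) = X≗ x y
⊎-adj-cong X≗ a≗ b≗ (inj₂ x) (inj₁ y) = X≗ y x
⊎-adj-cong X≗ a≗ b≗ (inj₂ x) (inj₂ y) = b≗ x y

⊎-adj-map : ∀ {A B A′ B′ : Set} (X : A′ → B′ → Bool) (a : A′ → A′ → Bool) (b : B′ → B′ → Bool)
            (f : A → A′) (g : B → B′) (u v : A ⊎ B) →
            ⊎-adj X a b (map f g u) (map f g v) ≡
            ⊎-adj (λ x y → X (f x) (g y)) (λ x y → a (f x) (f y)) (λ x y → b (g x) (g y)) u v
⊎-adj-map X a b f g (inj₁ x) (inj₁ y) = refl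
⊎-adj-map X a b f g (inj₁ x) (inj₂ y) = refl
⊎-adj-map X a b f g (inj₂ x) (inj₁ y) = refl
⊎-adj-map X a b f g (inj₂ x) (inj₂ y) = refl

glueAdj : ∀ {m n} → (Fin m → Fin n → Bool) → (Fin m → Fin m → Bool) → (Fin n → Fin n → Bool) →
          Fin (m + n) → Fin (m + n) → Bool
glueAdj {m} X a b i j = ⊎-adj X a b (splitAt m i) (splitAt m j)

glueAdj-cong : ∀ {m n} {X X′ : Fin m → Fin n → Bool} {a a′ b b′} →
               X ≗₂ X′ → a ≗₂ a′ → b ≗₂ b′ → glueAdj X a b ≗₂ glueAdj X′ a′ b′
glueAdj-cong {m} X≗ a≗ b≗ i j = ⊎-adj-cong X≗ a≗ b≗ (splitAt m i) (splitAt m j)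

coAdj-glueAdj : ∀ {m n} (X : Fin m → Fin n → Bool) a b →
                coAdj (glueAdj X a b) ≗₂ glueAdj (λ x y → not (X x y)) (coAdj a) (coAdj b)
coAdj-glueAdj {m} X a b i j = begin
  (if i == j then false else not (glueAdj X a b i j))
    ≡⟨ cong (λ c → if c then false else not (glueAdj X a b i j))
            (sym (⌊≟⌋-injective _≟_ (≡-dec _≟_ _≟_) (↔-injective +↔⊎) i j)) ⟩
  (if ⌊ ≡-dec _≟_ _≟_ (splitAt m i) (splitAt m j) ⌋ then false else not (glueAdj X a b i j))
    ≡⟨ ⊎-coAdj (splitAt m i) (splitAt m j) ⟩
  glueAdj (λ x y → not (X x y)) (coAdj a) (coAdj b) i j ∎
  where
  open ≡-Reasoning
  ⊎-coAdj : ∀ u v → (if ⌊ ≡-dec _≟_ _≟_ u v ⌋ then false else not (⊎-adj X a b u v)) ≡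
                    ⊎-adj (λ x y → not (X x y)) (coAdj a) (coAdj b) u v
  ⊎-coAdj (inj₁ x) (inj₁ y) with x ≟ y
  ... | yes _ = refl
  ... | no _  = refl
  ⊎-coAdj (inj₁ x) (inj₂ y) = refl
  ⊎-coAdj (inj₂ x) (inj₁ y) = refl
  ⊎-coAdj (inj₂ x) (inj₂ y) with x ≟ y
  ... | yes _ = refl
  ... | no _  = refl

glue : Bool → Graph → Graph → Graph
glue c G H = mkGraph (size G + size H) (glueAdj (λ _ _ → c) (adj G) (adj H))

⊕≅glue : ∀ G H → (G ⊕ H) ≅ glue false G H
⊕≅glue G H = ≗⇒≅ ⊕≗glue
  where
  ⊕≗glue : adj (G ⊕ H) ≗₂ glueAdj (λ _ _ → false) (adj G) (adj H)
  ⊕≗glue i j with splitAt (size G) i | splitAt (size G) j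
  ... | inj₁ x | inj₁ y = refl
  ... | inj₁ x | inj₂ y = refl
  ... | inj₂ x | inj₁ y = refl
  ... | inj₂ x | inj₂ y = refl

glue-cong : ∀ {c G G′ H H′} → G ≅ G′ → H ≅ H′ → glue c G H ≅ glue c G′ H′
glue-cong {c} {G} {G′} {H} {H′} φ ψ = record
  { bij      = ↔-trans +↔⊎ (↔-trans (⊎-cong β γ) (↔-sym +↔⊎))
  ; preserve = preserve }
  where
  open ≡-Reasoning
  β : Fin (size G) ↔ Fin (size G′)
  β = _≅_.bij φ
  γ : Fin (size H) ↔ Fin (size H′)
  γ = _≅_.bij ψ
  βγ : Fin (size G) ⊎ Fin (size H) → Fin (size G′) ⊎ Fin (size H′)
  βγ = map (to β) (to γ)
  preserve : ∀ i j → adj (glue c G H) i j ≡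
                     adj (glue c G′ H′) (join _ _ (βγ (splitAt _ i))) (join _ _ (βγ (splitAt _ j)))
  preserve i j = begin
    ⊎-adj (λ _ _ → c) (adj G) (adj H) u v
      ≡⟨ ⊎-adj-cong (λ _ _ → refl) (_≅_.preserve φ) (_≅_.preserve ψ) u v ⟩
    ⊎-adj (λ _ _ → c) (λ x y → adj G′ (to β x) (to β y)) (λ x y → adj H′ (to γ x) (to γ y)) u v
      ≡⟨ ⊎-adj-map (λ _ _ → c) (adj G′) (adj H′) (to β) (to γ) u v ⟨
    ⊎-adj (λ _ _ → c) (adj G′) (adj H′) (βγ u) (βγ v)
      ≡⟨ cong₂ (⊎-adj (λ _ _ → c) (adj G′) (adj H′)) (splitAt-join _ _ (βγ u)) (splitAt-join _ _ (βγ v)) ⟨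
    ⊎-adj (λ _ _ → c) (adj G′) (adj H′) (splitAt _ (join _ _ (βγ u))) (splitAt _ (join _ _ (βγ v))) ∎
    where
    u v : Fin (size G) ⊎ Fin (size H)
    u = splitAt (size G) i
    v = splitAt (size G) j

complement-glue : ∀ c G H → complement (glue c G H) ≅ glue (not c) (complement G) (complement H)
complement-glue c G H = ≗⇒≅ (coAdj-glueAdj (λ _ _ → c) (adj G) (adj H))

⊕-identityʳ : ∀ G → (G ⊕ emptyGraph) ≅ G
⊕-identityʳ G =
  ≅-trans (⊕≅glue G emptyGraph) (record { bij = ↔-trans +↔⊎ dropRight ; preserve = glue-empty })
  where
  dropRight : (Fin (size G) ⊎ Fin 0) ↔ Fin (size G)
  dropRight = mk↔ₛ′ [ id , (λ ()) ] inj₁ (λ _ → refl) [ (λ _ → refl) , (λ ()) ]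
  glue-empty : ∀ i j → adj (glue false G emptyGraph) i j ≡
                       adj G (to dropRight (splitAt (size G) i)) (to dropRight (splitAt (size G) j))
  glue-empty i j with splitAt (size G) i | splitAt (size G) j
  ... | inj₁ x | inj₁ y = refl

-- NLC-width expressions

nlcAdj-times : ∀ {k m n} (S : Fin k → Fin k → Bool) (e : NLCExpr k m) (f : NLCExpr k n) →
               nlcAdj (times S e f) ≗₂ glueAdj (λ x y → S (nlcLabel e x) (nlcLabel f y)) (nlcAdj e) (nlcAdj f)
nlcAdj-times {m = m} S e f i j with splitAt m i | splitAt m j
... | inj₁ x | inj₁ y = refl
... | inj₁ x | inj₂ y = refl
... | inj₂ x | inj₁ y = refl
... | inj₂ x | inj₂ y = refl

coNLC : ∀ {k n} → NLCExpr k n → NLCExpr k n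
coNLC (vert a)      = vert a
coNLC (times S e f) = times (λ x y → not (S x y)) (coNLC e) (coNLC f)
coNLC (relab R e)   = relab R (coNLC e)

nlcLabel-coNLC : ∀ {k n} (e : NLCExpr k n) i → nlcLabel (coNLC e) i ≡ nlcLabel e i
nlcLabel-coNLC (vert a) i = refl
nlcLabel-coNLC (times {m} S e f) i with splitAt m i
... | inj₁ x = nlcLabel-coNLC e x
... | inj₂ y = nlcLabel-coNLC f y
nlcLabel-coNLC (relab R e) i = cong R (nlcLabel-coNLC e i)

nlcAdj-coNLC : ∀ {k n} (e : NLCExpr k n) → nlcAdj (coNLC e) ≗₂ coAdj (nlcAdj e)
nlcAdj-coNLC (vert a) zero zero = refl
nlcAdj-coNLC (times S e f) i j = begin
  nlcAdj (coNLC (times S e f)) i j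
    ≡⟨ nlcAdj-times _ (coNLC e) (coNLC f) i j ⟩
  glueAdj (λ x y → not (S (nlcLabel (coNLC e) x) (nlcLabel (coNLC f) y))) (nlcAdj (coNLC e)) (nlcAdj (coNLC f)) i j
    ≡⟨ glueAdj-cong (λ x y → cong₂ (λ l l′ → not (S l l′)) (nlcLabel-coNLC e x) (nlcLabel-coNLC f y))
                    (nlcAdj-coNLC e) (nlcAdj-coNLC f) i j ⟩
  glueAdj (λ x y → not (S (nlcLabel e x) (nlcLabel f y))) (coAdj (nlcAdj e)) (coAdj (nlcAdj f)) i j
    ≡⟨ coAdj-glueAdj _ (nlcAdj e) (nlcAdj f) i j ⟨
  coAdj (glueAdj (λ x y → S (nlcLabel e x) (nlcLabel f y)) (nlcAdj e) (nlcAdj f)) i j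
    ≡⟨ coAdj-cong (nlcAdj-times S e f) i j ⟨
  coAdj (nlcAdj (times S e f)) i j ∎
  where open ≡-Reasoning
nlcAdj-coNLC (relab R e) = nlcAdj-coNLC e

rootLabel : ∀ {k} → Bool → Fin (suc (suc k))
rootLabel true  = 0F
rootLabel false = 1F

park : Fin 3 → Fin 3
park 0F = 2F
park l  = l

unpark : Fin 3 → Fin 3
unpark 2F = 1F
unpark l  = l

leftRoots : ∀ {m n} → (Fin m → Bool) → Fin (m + n) → Bool
leftRoots {m} r i = [ r , (λ _ → false) ] (splitAt m i)

-- Label 0 marks the roots and 1 the other vertices; the root of f is parked at 2 while the edges
-- between e and f are added.
nlcNode : ∀ {m n} → (Bool → Bool → Bool) → NLCExpr 3 m → NLCExpr 3 n → NLCExpr 3 (m + n)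
nlcNode T e f = relab unpark (times (λ l l′ → T (l == 0F) (l′ == 2F)) e (relab park f))

module _ {m n} (T : Bool → Bool → Bool) {e : NLCExpr 3 m} {f : NLCExpr 3 n} {r : Fin m → Bool} {r′ : Fin n → Bool}
         (e-labels : ∀ x → nlcLabel e x ≡ rootLabel (r x)) (f-labels : ∀ y → nlcLabel f y ≡ rootLabel (r′ y)) where

  nlcLabel-nlcNode : ∀ i → nlcLabel (nlcNode T e f) i ≡ rootLabel (leftRoots r i)
  nlcLabel-nlcNode i with splitAt m i
  ... | inj₁ x rewrite e-labels x with r x
  ...   | true  = refl
  ...   | false = refl
  nlcLabel-nlcNode i | inj₂ y rewrite f-labels y with r′ y
  ...   | true  = refl
  ...   | false = refl

  nlcAdj-nlcNode : nlcAdj (nlcNode T e f) ≗₂ glueAdj (λ x y → T (r x) (r′ y)) (nlcAdj e) (nlcAdj f)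
  nlcAdj-nlcNode i j =
    trans (nlcAdj-times _ e (relab park f) i j) (glueAdj-cong roots (λ _ _ → refl) (λ _ _ → refl) i j)
    where
    is-rootLabel : ∀ c → (rootLabel c == 0F) ≡ c
    is-rootLabel true  = refl
    is-rootLabel false = refl
    is-parkedRoot : ∀ c → (park (rootLabel c) == 2F) ≡ c
    is-parkedRoot true  = refl
    is-parkedRoot false = refl
    roots : ∀ x y → T (nlcLabel e x == 0F) (park (nlcLabel f y) == 2F) ≡ T (r x) (r′ y)
    roots x y rewrite e-labels x | f-labels y = cong₂ T (is-rootLabel (r x)) (is-parkedRoot (r′ y))

-- Clique-width expressions

rename : ∀ {k} → Fin k → Fin k → Fin k → Fin k
rename a b l = if l == a then b else l

links : ∀ {k} → Fin k → Fin k → Fin k → Fin k → Bool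
links a b l l′ = (l == a ∧ l′ == b) ∨ (l == b ∧ l′ == a)

record Realises {k n} (W : CWExpr k n) (ℓ : Fin n → Fin k) (α : Fin n → Fin n → Bool) : Set where
  field
    labels : ∀ i → cwLabel W i ≡ ℓ i
    edges  : cwAdj W ≗₂ α
open Realises

realises-self : ∀ {k n} (W : CWExpr k n) → Realises W (cwLabel W) (cwAdj W)
realises-self W = record { labels = λ _ → refl ; edges = λ _ _ → refl }

realises-cong : ∀ {k n} {W : CWExpr k n} {ℓ ℓ′ α α′} → (∀ i → ℓ i ≡ ℓ′ i) → α ≗₂ α′ →
                Realises W ℓ α → Realises W ℓ′ α′
realises-cong ℓ≗ α≗ R = record
  { labels = λ i → trans (labels R i) (ℓ≗ i)
  ; edges  = λ i j → trans (edges R i j) (α≗ i j) }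

realises-union : ∀ {k m n} {e : CWExpr k m} {f : CWExpr k n} {ℓ ℓ′ α α′} → Realises e ℓ α → Realises f ℓ′ α′ →
                 Realises (union e f) (λ i → [ ℓ , ℓ′ ] (splitAt m i)) (glueAdj (λ _ _ → false) α α′)
realises-union {m = m} {e = e} {f} {ℓ} {ℓ′} {α} {α′} eR fR = record { labels = union-labels ; edges = union-edges }
  where
  union-labels : ∀ i → cwLabel (union e f) i ≡ [ ℓ , ℓ′ ] (splitAt m i)
  union-labels i with splitAt m i
  ... | inj₁ x = labels eR x
  ... | inj₂ y = labels fR y
  union-edges : cwAdj (union e f) ≗₂ glueAdj (λ _ _ → false) α α′
  union-edges i j with splitAt m i | splitAt m j
  ... | inj₁ x | inj₁ y = edges eR x y
  ... | inj₁ x | inj₂ y = refl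
  ... | inj₂ x | inj₁ y = refl
  ... | inj₂ x | inj₂ y = edges fR x y

realises-relab : ∀ {k n} {W : CWExpr k n} {ℓ α} a b (a≢b : a ≢ b) → Realises W ℓ α →
                 Realises (relab a b a≢b W) (rename a b ∘ ℓ) α
realises-relab a b _ R = record
  { labels = λ i → cong (rename a b) (labels R i)
  ; edges  = edges R }

etaIf : ∀ {k n} → Bool → (a b : Fin k) → a ≢ b → CWExpr k n → CWExpr k n
etaIf true  a b a≢b W = eta a b a≢b W
etaIf false _ _ _   W = W

addIf : ∀ {k n} → Bool → Fin k → Fin k → (Fin n → Fin k) → (Fin n → Fin n → Bool) → Fin n → Fin n → Bool
addIf c a b ℓ α i j = if links a b (ℓ i) (ℓ j) then α i j ∨ c else α i j

realises-etaIf : ∀ {k n} {W : CWExpr k n} {ℓ α} c a b (a≢b : a ≢ b) → Realises W ℓ α →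
                 Realises (etaIf c a b a≢b W) ℓ (addIf c a b ℓ α)
realises-etaIf {W = W} {ℓ} {α} c a b a≢b R = record { labels = etaIf-labels c ; edges = etaIf-edges c }
  where
  etaIf-labels : ∀ c i → cwLabel (etaIf c a b a≢b W) i ≡ ℓ i
  etaIf-labels true  = labels R
  etaIf-labels false = labels R
  etaIf-edges : ∀ c → cwAdj (etaIf c a b a≢b W) ≗₂ addIf c a b ℓ α
  etaIf-edges true i j rewrite edges R i j | labels R i | labels R j with links a b (ℓ i) (ℓ j)
  ... | true  = refl
  ... | false = ∨-identityʳ (α i j)
  etaIf-edges false i j rewrite edges R i j with links a b (ℓ i) (ℓ j)
  ... | true  = sym (∨-identityʳ (α i j))
  ... | false = refl

crossEtas : ∀ {n} → (Bool → Bool → Bool) → CWExpr 4 n → CWExpr 4 n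
crossEtas T W =
  etaIf (T true true) 0F 2F (λ ()) (etaIf (T true false) 0F 3F (λ ()) (etaIf (T false true) 1F 2F (λ ())
    (etaIf (T false false) 1F 3F (λ ()) W)))

crossAdj : ∀ {n} → (Bool → Bool → Bool) → (Fin n → Fin 4) → (Fin n → Fin n → Bool) → Fin n → Fin n → Bool
crossAdj T ℓ α =
  addIf (T true true) 0F 2F ℓ (addIf (T true false) 0F 3F ℓ (addIf (T false true) 1F 2F ℓ
    (addIf (T false false) 1F 3F ℓ α)))

realises-crossEtas : ∀ {n} {W : CWExpr 4 n} {ℓ α} T → Realises W ℓ α → Realises (crossEtas T W) ℓ (crossAdj T ℓ α)
realises-crossEtas T R =
  realises-etaIf _ _ _ _ (realises-etaIf _ _ _ _ (realises-etaIf _ _ _ _ (realises-etaIf _ _ _ _ R)))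

parkedLabel : Bool → Fin 4
parkedLabel true  = 2F
parkedLabel false = 3F

-- f is moved to labels 2 (root) and 3 (other vertices), so that each of the four root/non-root
-- pairs of classes across e and f is joined by its own eta.
cwNode : ∀ {m n} → (Bool → Bool → Bool) → CWExpr 4 m → CWExpr 4 n → CWExpr 4 (m + n)
cwNode T e f =
  relab 3F 1F (λ ()) (relab 2F 1F (λ ()) (crossEtas T (union e (relab 1F 3F (λ ()) (relab 0F 2F (λ ()) f)))))

module _ {m n} (T : Bool → Bool → Bool) {e : CWExpr 4 m} {f : CWExpr 4 n} {r : Fin m → Bool} {r′ : Fin n → Bool}
         {α : Fin m → Fin m → Bool} {α′ : Fin n → Fin n → Bool} where

  private
    ℓ : Fin (m + n) → Fin 4
    ℓ i = [ rootLabel ∘ r , parkedLabel ∘ r′ ] (splitAt m i)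

    parked : ∀ c → rename 1F 3F (rename 0F 2F (rootLabel c)) ≡ parkedLabel c
    parked true  = refl
    parked false = refl

    merged : ∀ i → rename 3F 1F (rename 2F 1F (ℓ i)) ≡ rootLabel (leftRoots r i)
    merged i with splitAt m i
    ... | inj₁ x with r x
    ...   | true  = refl
    ...   | false = refl
    merged i | inj₂ y with r′ y
    ...   | true  = refl
    ...   | false = refl

    crossed : crossAdj T ℓ (glueAdj (λ _ _ → false) α α′) ≗₂ glueAdj (λ x y → T (r x) (r′ y)) α α′
    crossed i j with splitAt m i | splitAt m j
    ... | inj₁ x | inj₁ y with r x | r y
    ...   | true  | true  = refl
    ...   | true  | false = refl
    ...   | false | true  = refl
    ...   | false | false = refl
    crossed i j | inj₁ x | inj₂ y with r x | r′ y
    ...   | true  | true  = refl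
    ...   | true  | false = refl
    ...   | false | true  = refl
    ...   | false | false = refl
    crossed i j | inj₂ x | inj₁ y with r′ x | r y
    ...   | true  | true  = refl
    ...   | true  | false = refl
    ...   | false | true  = refl
    ...   | false | false = refl
    crossed i j | inj₂ x | inj₂ y with r′ x | r′ y
    ...   | true  | true  = refl
    ...   | true  | false = refl
    ...   | false | true  = refl
    ...   | false | false = refl

  realises-cwNode : Realises e (rootLabel ∘ r) α → Realises f (rootLabel ∘ r′) α′ →
                    Realises (cwNode T e f) (rootLabel ∘ leftRoots r) (glueAdj (λ x y → T (r x) (r′ y)) α α′)
  realises-cwNode eR fR =
    realises-cong merged crossed
      (realises-relab _ _ _ (realises-relab _ _ _ (realises-crossEtas T (realises-union eR parkedR))))
    where
    parkedR : Realises (relab 1F 3F (λ ()) (relab 0F 2F (λ ()) f)) (parkedLabel ∘ r′) α′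
    parkedR = realises-cong (λ y → parked (r′ y)) (λ _ _ → refl) (realises-relab _ _ _ (realises-relab _ _ _ fR))

collapse : ∀ {n} → CWExpr 4 n → CWExpr 4 n
collapse e = relab 3F 0F (λ ()) (relab 2F 0F (λ ()) (relab 1F 0F (λ ()) e))

realises-collapse : ∀ {n} (e : CWExpr 4 n) → Realises (collapse e) (λ _ → 0F) (cwAdj e)
realises-collapse e = realises-cong (λ i → to-0F (cwLabel e i)) (λ _ _ → refl)
  (realises-relab _ _ _ (realises-relab _ _ _ (realises-relab _ _ _ (realises-self e))))
  where
  to-0F : (l : Fin 4) → rename 3F 0F (rename 2F 0F (rename 1F 0F l)) ≡ 0F
  to-0F 0F = refl
  to-0F 1F = refl
  to-0F 2F = refl
  to-0F 3F = refl

cwJoin : ∀ {m n} → CWExpr 4 m → CWExpr 4 n → CWExpr 4 (m + n)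
cwJoin e f = cwNode (λ _ _ → true) (collapse e) (collapse f)

cwGraph-join : ∀ {m n} (e : CWExpr 4 m) (f : CWExpr 4 n) →
               cwGraph (cwJoin e f) ≅ glue true (cwGraph e) (cwGraph f)
cwGraph-join e f = ≗⇒≅ (edges (realises-cwNode (λ _ _ → true) {r = λ _ → true} {r′ = λ _ → true}
                                                 (realises-collapse e) (realises-collapse f)))

cwGraph-union : ∀ {m n} (e : CWExpr 4 m) (f : CWExpr 4 n) →
                cwGraph (union e f) ≅ glue false (cwGraph e) (cwGraph f)
cwGraph-union e f = ≗⇒≅ (edges (realises-union (realises-self e) (realises-self f)))

-- Rooted forests

-- node b s t puts s and t side by side, joins their roots iff b, and keeps the root of s.
data Shape : Set where
  leaf : Shape
  node : Bool → Shape → Shape → Shape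

Vertex : Shape → Set
Vertex leaf         = ⊤
Vertex (node _ s t) = Vertex s ⊎ Vertex t

isRoot : (t : Shape) → Vertex t → Bool
isRoot leaf         _ = true
isRoot (node _ s _)   = [ isRoot s , (λ _ → false) ]

crossing : Bool → Bool → Bool → Bool
crossing b x y = b ∧ (x ∧ y)

edge : (t : Shape) → Vertex t → Vertex t → Bool
edge leaf         _ _ = false
edge (node b s t)     = ⊎-adj (λ x y → crossing b (isRoot s x) (isRoot t y)) (edge s) (edge t)

∣_∣ : Shape → ℕ
∣ leaf ∣       = 1
∣ node _ s t ∣ = ∣ s ∣ + ∣ t ∣

enumerate : (t : Shape) → Fin ∣ t ∣ ↔ Vertex t
enumerate leaf         = 1↔⊤
enumerate (node _ s t) = ↔-trans +↔⊎ (⊎-cong (enumerate s) (enumerate t))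

shapeGraph : Shape → Graph
shapeGraph t = mkGraph ∣ t ∣ (λ i j → edge t (to (enumerate t) i) (to (enumerate t) j))

shapeGraph≃edge : ∀ t → shapeGraph t ≃ edge t
shapeGraph≃edge t = record { vertices = enumerate t ; preserves = λ _ _ → refl }

shapeRoot : (t : Shape) → Fin ∣ t ∣ → Bool
shapeRoot t i = isRoot t (to (enumerate t) i)

shapeRoot-node : ∀ b s t i → shapeRoot (node b s t) i ≡ leftRoots (shapeRoot s) i
shapeRoot-node b s t i = [,]-map (splitAt ∣ s ∣ i)

shapeAdj-node : ∀ b s t → adj (shapeGraph (node b s t)) ≗₂
                glueAdj (λ x y → crossing b (shapeRoot s x) (shapeRoot t y)) (adj (shapeGraph s)) (adj (shapeGraph t))
shapeAdj-node b s t i j =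
  ⊎-adj-map (λ x y → crossing b (isRoot s x) (isRoot t y)) (edge s) (edge t) (to (enumerate s)) (to (enumerate t))
    (splitAt ∣ s ∣ i) (splitAt ∣ s ∣ j)

nlcShape : (t : Shape) → NLCExpr 3 ∣ t ∣
nlcShape leaf         = vert 0F
nlcShape (node b s t) = nlcNode (crossing b) (nlcShape s) (nlcShape t)

nlcLabel-nlcShape : ∀ t i → nlcLabel (nlcShape t) i ≡ rootLabel (shapeRoot t i)
nlcLabel-nlcShape leaf         i = refl
nlcLabel-nlcShape (node b s t) i =
  trans (nlcLabel-nlcNode (crossing b) (nlcLabel-nlcShape s) (nlcLabel-nlcShape t) i)
        (cong rootLabel (sym (shapeRoot-node b s t i)))

nlcAdj-nlcShape : ∀ t → nlcAdj (nlcShape t) ≗₂ adj (shapeGraph t)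
nlcAdj-nlcShape leaf         i j = refl
nlcAdj-nlcShape (node b s t) i j = begin
  nlcAdj (nlcShape (node b s t)) i j
    ≡⟨ nlcAdj-nlcNode (crossing b) (nlcLabel-nlcShape s) (nlcLabel-nlcShape t) i j ⟩
  glueAdj (λ x y → crossing b (shapeRoot s x) (shapeRoot t y)) (nlcAdj (nlcShape s)) (nlcAdj (nlcShape t)) i j
    ≡⟨ glueAdj-cong (λ _ _ → refl) (nlcAdj-nlcShape s) (nlcAdj-nlcShape t) i j ⟩
  glueAdj (λ x y → crossing b (shapeRoot s x) (shapeRoot t y)) (adj (shapeGraph s)) (adj (shapeGraph t)) i j
    ≡⟨ shapeAdj-node b s t i j ⟨
  adj (shapeGraph (node b s t)) i j ∎
  where open ≡-Reasoning

cwShape : (t : Shape) → CWExpr 4 ∣ t ∣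
cwShape leaf         = vert 0F
cwShape (node b s t) = cwNode (crossing b) (cwShape s) (cwShape t)

realises-cwShape : ∀ t → Realises (cwShape t) (rootLabel ∘ shapeRoot t) (adj (shapeGraph t))
realises-cwShape leaf         = record { labels = λ _ → refl ; edges = λ _ _ → refl }
realises-cwShape (node b s t) =
  realises-cong (λ i → cong rootLabel (sym (shapeRoot-node b s t i))) (λ i j → sym (shapeAdj-node b s t i j))
    (realises-cwNode (crossing b) (realises-cwShape s) (realises-cwShape t))

coCwShape : (t : Shape) → CWExpr 4 ∣ t ∣
coCwShape leaf         = vert 0F
coCwShape (node b s t) = cwNode (λ x y → not (crossing b x y)) (coCwShape s) (coCwShape t)

realises-coCwShape : ∀ t → Realises (coCwShape t) (rootLabel ∘ shapeRoot t) (coAdj (adj (shapeGraph t)))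
realises-coCwShape leaf         = record { labels = λ _ → refl ; edges = λ { zero zero → refl } }
realises-coCwShape (node b s t) =
  realises-cong (λ i → cong rootLabel (sym (shapeRoot-node b s t i))) co-node
    (realises-cwNode (λ x y → not (crossing b x y)) (realises-coCwShape s) (realises-coCwShape t))
  where
  co-node : glueAdj (λ x y → not (crossing b (shapeRoot s x) (shapeRoot t y)))
                    (coAdj (adj (shapeGraph s))) (coAdj (adj (shapeGraph t)))
            ≗₂ coAdj (adj (shapeGraph (node b s t)))
  co-node i j = trans (sym (coAdj-glueAdj _ (adj (shapeGraph s)) (adj (shapeGraph t)) i j))
                      (coAdj-cong (λ i j → sym (shapeAdj-node b s t i j)) i j)

vertex≟ : (t : Shape) → DecidableEquality (Vertex t)
vertex≟ leaf         = ⊤._≟_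
vertex≟ (node _ s t) = ≡-dec (vertex≟ s) (vertex≟ t)

edge-sym : ∀ t x y → edge t x y ≡ edge t y x
edge-sym leaf         _        _        = refl
edge-sym (node b s t) (inj₁ x) (inj₁ y) = edge-sym s x y
edge-sym (node b s t) (inj₁ x) (inj₂ y) = refl
edge-sym (node b s t) (inj₂ x) (inj₁ y) = refl
edge-sym (node b s t) (inj₂ x) (inj₂ y) = edge-sym t x y

edge-irrefl : ∀ t x → edge t x x ≡ false
edge-irrefl leaf         _        = refl
edge-irrefl (node b s t) (inj₁ x) = edge-irrefl s x
edge-irrefl (node b s t) (inj₂ y) = edge-irrefl t y

crossing-nonrootʳ : ∀ b x → crossing b x false ≡ false
crossing-nonrootʳ b true  = ∧-zeroʳ b
crossing-nonrootʳ b false = ∧-zeroʳ b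

addVertex : ∀ {A : Set} → (A → Bool) → (A → A → Bool) → ⊤ ⊎ A → ⊤ ⊎ A → Bool
addVertex nb E = ⊎-adj (λ _ → nb) (λ _ _ → false) E

attach : (t : Shape) → Vertex t → Shape
attach leaf         _        = node true leaf leaf
attach (node b s t) (inj₁ x) = node b (attach s x) t
attach (node b s t) (inj₂ y) = node b s (attach t y)

new : (t : Shape) (p : Vertex t) → Vertex (attach t p)
new leaf         _        = inj₂ tt
new (node b s t) (inj₁ x) = inj₁ (new s x)
new (node b s t) (inj₂ y) = inj₂ (new t y)

old : (t : Shape) (p : Vertex t) → Vertex t → Vertex (attach t p)
old leaf         _        _        = inj₁ tt
old (node b s t) (inj₁ x) (inj₁ z) = inj₁ (old s x z)
old (node b s t) (inj₁ x) (inj₂ z) = inj₂ z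
old (node b s t) (inj₂ y) (inj₁ z) = inj₁ z
old (node b s t) (inj₂ y) (inj₂ z) = inj₂ (old t y z)

grow : (t : Shape) (p : Vertex t) → ⊤ ⊎ Vertex t → Vertex (attach t p)
grow t p = [ (λ _ → new t p) , old t p ]

shrink : (t : Shape) (p : Vertex t) → Vertex (attach t p) → ⊤ ⊎ Vertex t
shrink leaf         _        (inj₁ _) = inj₂ tt
shrink leaf         _        (inj₂ _) = inj₁ tt
shrink (node b s t) (inj₁ x) (inj₁ z) = map₂ inj₁ (shrink s x z)
shrink (node b s t) (inj₁ x) (inj₂ z) = inj₂ (inj₂ z)
shrink (node b s t) (inj₂ y) (inj₁ z) = inj₂ (inj₁ z)
shrink (node b s t) (inj₂ y) (inj₂ z) = map₂ inj₂ (shrink t y z)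

grow-shrink : ∀ t p z → grow t p (shrink t p z) ≡ z
grow-shrink leaf         _        (inj₁ _) = refl
grow-shrink leaf         _        (inj₂ _) = refl
grow-shrink (node b s t) (inj₁ x) (inj₁ z) = trans (grow-left (shrink s x z)) (cong inj₁ (grow-shrink s x z))
  where
  grow-left : ∀ u → grow (node b s t) (inj₁ x) (map₂ inj₁ u) ≡ inj₁ (grow s x u)
  grow-left (inj₁ _) = refl
  grow-left (inj₂ _) = refl
grow-shrink (node b s t) (inj₁ x) (inj₂ z) = refl
grow-shrink (node b s t) (inj₂ y) (inj₁ z) = refl
grow-shrink (node b s t) (inj₂ y) (inj₂ z) = trans (grow-right (shrink t y z)) (cong inj₂ (grow-shrink t y z))
  where
  grow-right : ∀ u → grow (node b s t) (inj₂ y) (map₂ inj₂ u) ≡ inj₂ (grow t y u)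
  grow-right (inj₁ _) = refl
  grow-right (inj₂ _) = refl

shrink-new : ∀ t p → shrink t p (new t p) ≡ inj₁ tt
shrink-new leaf         _        = refl
shrink-new (node b s t) (inj₁ x) = cong (map₂ inj₁) (shrink-new s x)
shrink-new (node b s t) (inj₂ y) = cong (map₂ inj₂) (shrink-new t y)

shrink-old : ∀ t p z → shrink t p (old t p z) ≡ inj₂ z
shrink-old leaf         _        _        = refl
shrink-old (node b s t) (inj₁ x) (inj₁ z) = cong (map₂ inj₁) (shrink-old s x z)
shrink-old (node b s t) (inj₁ x) (inj₂ z) = refl
shrink-old (node b s t) (inj₂ y) (inj₁ z) = refl
shrink-old (node b s t) (inj₂ y) (inj₂ z) = cong (map₂ inj₂) (shrink-old t y z)

attach↔ : (t : Shape) (p : Vertex t) → (⊤ ⊎ Vertex t) ↔ Vertex (attach t p)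
attach↔ t p = mk↔ₛ′ (grow t p) (shrink t p) (grow-shrink t p) [ (λ _ → shrink-new t p) , shrink-old t p ]

isRoot-new : ∀ t p → isRoot (attach t p) (new t p) ≡ false
isRoot-new leaf         _        = refl
isRoot-new (node b s t) (inj₁ x) = isRoot-new s x
isRoot-new (node b s t) (inj₂ y) = refl

isRoot-old : ∀ t p z → isRoot (attach t p) (old t p z) ≡ isRoot t z
isRoot-old leaf         _        _        = refl
isRoot-old (node b s t) (inj₁ x) (inj₁ z) = isRoot-old s x z
isRoot-old (node b s t) (inj₁ x) (inj₂ z) = refl
isRoot-old (node b s t) (inj₂ y) (inj₁ z) = refl
isRoot-old (node b s t) (inj₂ y) (inj₂ z) = refl

edge-old : ∀ t p z z′ → edge (attach t p) (old t p z) (old t p z′) ≡ edge t z z′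
edge-old leaf         _        _        _         = refl
edge-old (node b s t) (inj₁ x) (inj₁ z) (inj₁ z′) = edge-old s x z z′
edge-old (node b s t) (inj₁ x) (inj₁ z) (inj₂ z′) = cong (λ c → crossing b c (isRoot t z′)) (isRoot-old s x z)
edge-old (node b s t) (inj₁ x) (inj₂ z) (inj₁ z′) = cong (λ c → crossing b c (isRoot t z)) (isRoot-old s x z′)
edge-old (node b s t) (inj₁ x) (inj₂ z) (inj₂ z′) = refl
edge-old (node b s t) (inj₂ y) (inj₁ z) (inj₁ z′) = refl
edge-old (node b s t) (inj₂ y) (inj₁ z) (inj₂ z′) = cong (crossing b (isRoot s z)) (isRoot-old t y z′)
edge-old (node b s t) (inj₂ y) (inj₂ z) (inj₁ z′) = cong (crossing b (isRoot s z′)) (isRoot-old t y z)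
edge-old (node b s t) (inj₂ y) (inj₂ z) (inj₂ z′) = edge-old t y z z′

edge-new-old : ∀ t p z → edge (attach t p) (new t p) (old t p z) ≡ does (vertex≟ t p z)
edge-new-old leaf         _        _        = refl
edge-new-old (node b s t) (inj₁ x) (inj₁ z) = edge-new-old s x z
edge-new-old (node b s t) (inj₁ x) (inj₂ z) rewrite isRoot-new s x = ∧-zeroʳ b
edge-new-old (node b s t) (inj₂ y) (inj₁ z) rewrite isRoot-new t y = crossing-nonrootʳ b (isRoot s z)
edge-new-old (node b s t) (inj₂ y) (inj₂ z) = edge-new-old t y z

edge-grow : ∀ t p u v → edge (attach t p) (grow t p u) (grow t p v) ≡ addVertex (does ∘ vertex≟ t p) (edge t) u v
edge-grow t p (inj₁ _) (inj₁ _) = edge-irrefl (attach t p) (new t p)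
edge-grow t p (inj₁ _) (inj₂ z) = edge-new-old t p z
edge-grow t p (inj₂ z) (inj₁ _) = trans (edge-sym (attach t p) (old t p z) (new t p)) (edge-new-old t p z)
edge-grow t p (inj₂ z) (inj₂ z′) = edge-old t p z z′

-- Leaves of acyclic graphs

AtMostOneNeighbour : (G : Graph) → Fin (size G) → Set
AtMostOneNeighbour G w = ∀ {y z} → adj G w y ≡ true → adj G w z ≡ true → y ≡ z

record Path (G : Graph) (k : ℕ) : Set where
  field
    vertex    : Fin (suc k) → Fin (size G)
    injective : Injective _≡_ _≡_ vertex
    steps     : ∀ (i : Fin k) → adj G (vertex (inject₁ i)) (vertex (suc i)) ≡ true

  head : Fin (size G)
  head = vertex zero
open Path

inject≤-toℕ : ∀ {m n} (i : Fin m) (j : Fin n) .(m≤n : m ≤ n) → toℕ i ≡ toℕ j → inject≤ i m≤n ≡ j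
inject≤-toℕ i j m≤n i≡j = toℕ-injective (trans (toℕ-inject≤ i m≤n) i≡j)

true≢false : true ≢ false
true≢false ()

module _ {G : Graph} (symmetric : ∀ i j → adj G i j ≡ adj G j i) (loopless : Loopless G) (acyclic : Acyclic G) where

  no-chord : ∀ {k} (P : Path G (suc k)) (j : Fin k) → adj G (head P) (vertex P (suc (suc j))) ≢ true
  no-chord {k} P j chord = acyclic record
    { p = toℕ j ; vs = vertex P ∘ prefix ; inj = inject≤-injective _ _ _ _ ∘ injective P
    ; edges = prefix-steps ; close = closing }
    where
    prefix : Fin (suc (suc (suc (toℕ j)))) → Fin (suc (suc k))
    prefix i = inject≤ i (s≤s (s≤s (toℕ<n j)))
    prefix-steps : ∀ i → adj G (vertex P (prefix (inject₁ i))) (vertex P (prefix (suc i))) ≡ true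
    prefix-steps i =
      subst (λ v → adj G (vertex P v) (vertex P (prefix (suc i))) ≡ true) (sym prefix-inject₁) (steps P i′)
      where
      i′ : Fin (suc k)
      i′ = inject≤ i (s≤s (toℕ<n j))
      prefix-inject₁ : prefix (inject₁ i) ≡ inject₁ i′
      prefix-inject₁ = inject≤-toℕ (inject₁ i) (inject₁ i′) _ (begin
        toℕ (inject₁ i)  ≡⟨ toℕ-inject₁ i ⟩
        toℕ i            ≡⟨ toℕ-inject≤ i _ ⟨
        toℕ i′           ≡⟨ toℕ-inject₁ i′ ⟨
        toℕ (inject₁ i′) ∎)
        where open ≡-Reasoning
    closing : adj G (vertex P (prefix (fromℕ (suc (suc (toℕ j)))))) (head P) ≡ true
    closing = subst (λ v → adj G (vertex P v) (head P) ≡ true) (sym prefix-last) (trans (symmetric _ _) chord)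
      where
      prefix-last : prefix (fromℕ (suc (suc (toℕ j)))) ≡ suc (suc j)
      prefix-last =
        inject≤-toℕ (fromℕ _) (suc (suc j)) (s≤s (s≤s (toℕ<n j))) (toℕ-fromℕ (suc (suc (toℕ j))))

  path-neighbours-agree : ∀ {k} (P : Path G k) {i i′} →
                          adj G (head P) (vertex P i) ≡ true → adj G (head P) (vertex P i′) ≡ true → i ≡ i′
  path-neighbours-agree P {zero}          loop _    = ⊥-elim (true≢false (trans (sym loop) (loopless _)))
  path-neighbours-agree P {_} {zero}      _    loop = ⊥-elim (true≢false (trans (sym loop) (loopless _)))
  path-neighbours-agree P {suc (suc j)}   chord _   = ⊥-elim (no-chord P j chord)
  path-neighbours-agree P {_} {suc (suc j)} _ chord = ⊥-elim (no-chord P j chord)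
  path-neighbours-agree P {suc zero} {suc zero} _ _ = refl

  maximal-path-end : ∀ {k} (P : Path G k) → (∀ y → adj G (head P) y ≡ true → ∃ λ i → vertex P i ≡ y) →
                     AtMostOneNeighbour G (head P)
  maximal-path-end P onPath {y} {z} hy hz with onPath y hy | onPath z hz
  ... | i , refl | i′ , refl = cong (vertex P) (path-neighbours-agree P hy hz)

  extend : ∀ {k} (P : Path G k) {y} → adj G (head P) y ≡ true → ¬ (∃ λ i → vertex P i ≡ y) → Path G (suc k)
  extend {k} P {y} hy offPath = record { vertex = vertex′ ; injective = injective′ ; steps = steps′ }
    where
    vertex′ : Fin (suc (suc k)) → Fin (size G)
    vertex′ zero    = y
    vertex′ (suc i) = vertex P i
    injective′ : Injective _≡_ _≡_ vertex′
    injective′ {zero}  {zero}  _  = refl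
    injective′ {zero}  {suc j} eq = ⊥-elim (offPath (j , sym eq))
    injective′ {suc i} {zero}  eq = ⊥-elim (offPath (i , eq))
    injective′ {suc i} {suc j} eq = cong suc (injective P eq)
    steps′ : ∀ (i : Fin (suc k)) → adj G (vertex′ (inject₁ i)) (vertex′ (suc i)) ≡ true
    steps′ zero    = trans (symmetric _ _) hy
    steps′ (suc i) = steps P i

  longest-path-end : ∀ fuel {k} (P : Path G k) → size G ≤ fuel + suc k → ∃ (AtMostOneNeighbour G)
  longest-path-end fuel P bound
    with any? (λ y → (adj G (head P) y Bool.≟ true) ×-dec ¬? (any? λ i → vertex P i ≟ y))
  ... | no stuck = head P , maximal-path-end P λ y hy →
          decidable-stable (any? λ i → vertex P i ≟ y) (λ offPath → stuck (y , hy , offPath))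
  ... | yes (y , hy , offPath) with fuel
  ...   | zero       = ⊥-elim (<-irrefl refl (≤-trans (injective⇒≤ (injective (extend P hy offPath))) bound))
  ...   | suc fuel′  =
    longest-path-end fuel′ (extend P hy offPath) (subst (size G ≤_) (sym (+-suc fuel′ _)) bound)

  leaf-exists : Fin (size G) → ∃ (AtMostOneNeighbour G)
  leaf-exists x = longest-path-end (size G) trivial (m≤m+n (size G) 1)
    where
    trivial : Path G 0
    trivial = record { vertex = λ _ → x ; injective = λ { {zero} {zero} _ → refl } ; steps = λ () }

-- Every forest is the graph of a rooted forest

removeAt : ∀ {m} → Fin (suc m) → Fin (suc m) → ⊤ ⊎ Fin m
removeAt w i with w ≟ i
... | yes _   = inj₁ tt
... | no w≢i  = inj₂ (punchOut w≢i)

removeAt-self : ∀ {m} (w : Fin (suc m)) → removeAt w w ≡ inj₁ tt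
removeAt-self w with w ≟ w
... | yes _   = refl
... | no w≢w  = ⊥-elim (w≢w refl)

removeAt-punchIn : ∀ {m} (w : Fin (suc m)) k → removeAt w (punchIn w k) ≡ inj₂ k
removeAt-punchIn w k with w ≟ punchIn w k
... | yes w≡ = ⊥-elim (punchInᵢ≢i w k (sym w≡))
... | no w≢  = cong inj₂ (trans (punchOut-cong w refl) (punchOut-punchIn w))

removeAt↔ : ∀ {m} (w : Fin (suc m)) → Fin (suc m) ↔ (⊤ ⊎ Fin m)
removeAt↔ w = mk↔ₛ′ (removeAt w) [ (λ _ → w) , punchIn w ] removeAt-insert insert-removeAt
  where
  removeAt-insert : ∀ u → removeAt w ([ (λ _ → w) , punchIn w ] u) ≡ u
  removeAt-insert (inj₁ _) = removeAt-self w
  removeAt-insert (inj₂ k) = removeAt-punchIn w k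
  insert-removeAt : ∀ i → [ (λ _ → w) , punchIn w ] (removeAt w i) ≡ i
  insert-removeAt i with w ≟ i
  ... | yes w≡i = w≡i
  ... | no w≢i  = punchIn-punchOut w≢i

data Excision {m} (w : Fin (suc m)) : Fin (suc m) → Set where
  removed : Excision w w
  kept    : ∀ k → Excision w (punchIn w k)

excision : ∀ {m} (w i : Fin (suc m)) → Excision w i
excision w i with w ≟ i
... | yes refl = removed
... | no w≢i   = subst (Excision w) (punchIn-punchOut w≢i) (kept (punchOut w≢i))

delete : ∀ {m} → (Fin (suc m) → Fin (suc m) → Bool) → Fin (suc m) → Fin m → Fin m → Bool
delete a w i j = a (punchIn w i) (punchIn w j)

acyclic-induced : ∀ {m n} {a : Fin n → Fin n → Bool} (f : Fin m → Fin n) → Injective _≡_ _≡_ f →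
                  Acyclic (mkGraph n a) → Acyclic (mkGraph m (λ i j → a (f i) (f j)))
acyclic-induced f f-inj acyclic C = acyclic record
  { p = Cycle.p C ; vs = f ∘ Cycle.vs C ; inj = Cycle.inj C ∘ f-inj ; edges = Cycle.edges C ; close = Cycle.close C }

≃-addVertex : ∀ {m} {a : Fin (suc m) → Fin (suc m) → Bool} {A : Set} {E : A → A → Bool} w (nb : A → Bool) →
              IsSimple (mkGraph (suc m) a) → (φ : mkGraph m (delete a w) ≃ E) →
              (∀ k → a w (punchIn w k) ≡ nb (to (vertices φ) k)) → mkGraph (suc m) a ≃ addVertex nb E
≃-addVertex {m} {a} {A} {E} w nb (symmetric , loopless) φ w-adj = record
  { vertices = ↔-trans (removeAt↔ w) (⊎-cong ↔-refl β) ; preserves = preserves′ }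
  where
  β : Fin m ↔ A
  β = vertices φ
  preserves′ : ∀ i j → a i j ≡ addVertex nb E (map id (to β) (removeAt w i)) (map id (to β) (removeAt w j))
  preserves′ i j with excision w i | excision w j
  ... | removed | removed rewrite removeAt-self w = loopless w
  ... | removed | kept l  rewrite removeAt-self w | removeAt-punchIn w l = w-adj l
  ... | kept k  | removed rewrite removeAt-self w | removeAt-punchIn w k = trans (symmetric _ w) (w-adj k)
  ... | kept k  | kept l  rewrite removeAt-punchIn w k | removeAt-punchIn w l = preserves φ k l

pendant-neighbourhood : ∀ {m} {a : Fin (suc m) → Fin (suc m) → Bool} {A : Set} (_≟ᴬ_ : DecidableEquality A)
                        (β : Fin m ↔ A) {w u} (w≢u : w ≢ u) → a w u ≡ true → AtMostOneNeighbour (mkGraph (suc m) a) w →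
                        ∀ k → a w (punchIn w k) ≡ does (to β (punchOut w≢u) ≟ᴬ to β k)
pendant-neighbourhood {a = a} _≟ᴬ_ β {w} {u} w≢u wu w-leaf k with a w (punchIn w k) in wk
... | true  = sym (dec-true (to β (punchOut w≢u) ≟ᴬ to β k)
                    (cong (to β) (punchIn-injective w _ _ (trans (punchIn-punchOut w≢u) (w-leaf wu wk)))))
... | false = sym (dec-false (to β (punchOut w≢u) ≟ᴬ to β k) λ βu≡βk →
                    true≢false (trans (sym wu) (trans (cong (a w) (u≡ βu≡βk)) wk)))
  where
  u≡ : to β (punchOut w≢u) ≡ to β k → u ≡ punchIn w k
  u≡ βu≡βk = trans (sym (punchIn-punchOut w≢u)) (cong (punchIn w) (↔-injective β βu≡βk))

shapeOf : ∀ n (a : Fin (suc n) → Fin (suc n) → Bool) → IsSimple (mkGraph (suc n) a) → Acyclic (mkGraph (suc n) a) →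
          Σ Shape λ t → mkGraph (suc n) a ≃ edge t
shapeOf zero    a (_ , loopless) _ = leaf , record { vertices = 1↔⊤ ; preserves = λ { 0F 0F → loopless 0F } }
shapeOf (suc n) a simple@(symmetric , loopless) acyclic with leaf-exists symmetric loopless acyclic 0F
... | w , w-leaf
    with shapeOf n (delete a w) ((λ i j → symmetric _ _) , (λ i → loopless _))
                   (acyclic-induced (punchIn w) (punchIn-injective w _ _) acyclic)
       | any? (λ u → a w u Bool.≟ true)
...   | t , φ | no isolated =
  -- edge (node false leaf t) is addVertex (λ _ → false) (edge t) on the nose.
  node false leaf t , ≃-addVertex w (λ _ → false) simple φ (λ k → ¬-not (λ wk → isolated (punchIn w k , wk)))
...   | t , φ | yes (u , wu) =
  attach t p ,
  ≃-trans (≃-addVertex w (does ∘ vertex≟ t p) simple φ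
                       (pendant-neighbourhood {a = a} (vertex≟ t) (vertices φ) w≢u wu w-leaf))
          (attach↔ t p) (λ x y → sym (edge-grow t p x y))
  where
  w≢u : w ≢ u
  w≢u refl = true≢false (trans (sym wu) (loopless w))
  p : Vertex t
  p = to (vertices φ) (punchOut w≢u)

InNLC-≅ : ∀ {k G H} → InNLC k G → G ≅ H → InNLC k H
InNLC-≅ (n , e , e≅G) G≅H = n , e , ≅-trans e≅G G≅H

InCW-≅ : ∀ {k G H} → InCW k G → G ≅ H → InCW k H
InCW-≅ (n , e , e≅G) G≅H = n , e , ≅-trans e≅G G≅H

record SmallWidth (G : Graph) : Set where
  field
    loopless : Loopless G
    nlc      : InNLC 3 G
    cw       : InCW 4 G
    co-cw    : InCW 4 (complement G)
open SmallWidth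

SmallWidth-≅ : ∀ {G H} → SmallWidth G → G ≅ H → SmallWidth H
SmallWidth-≅ w φ = record
  { loopless = ≅-loopless φ (loopless w)
  ; nlc      = InNLC-≅ (nlc w) φ
  ; cw       = InCW-≅ (cw w) φ
  ; co-cw    = InCW-≅ (co-cw w) (complement-cong φ) }

SmallWidth-complement : ∀ {G} → SmallWidth G → SmallWidth (complement G)
SmallWidth-complement {G} w = record
  { loopless = complement-loopless G
  ; nlc      = let (n , e , e≅G) = nlc w in
               n , coNLC e , ≅-trans (≗⇒≅ (nlcAdj-coNLC e)) (complement-cong e≅G)
  ; cw       = co-cw w
  ; co-cw    = InCW-≅ (cw w) (≅-sym (complement-involutive G (loopless w))) }

glue-loopless : ∀ c {G H} → Loopless G → Loopless H → Loopless (glue c G H)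
glue-loopless c {G} G-loopless H-loopless i with splitAt (size G) i
... | inj₁ x = G-loopless x
... | inj₂ y = H-loopless y

SmallWidth-⊕ : ∀ {G H} → SmallWidth G → SmallWidth H → SmallWidth (G ⊕ H)
SmallWidth-⊕ {G} {H} wG wH = SmallWidth-≅ glued (≅-sym (⊕≅glue G H))
  where
  glued : SmallWidth (glue false G H)
  glued = record
    { loopless = glue-loopless false (loopless wG) (loopless wH)
    ; nlc      = let (m , e , e≅G) = nlc wG ; (n , f , f≅H) = nlc wH in
                 m + n , times (λ _ _ → false) e f , ≅-trans (≗⇒≅ (nlcAdj-times _ e f)) (glue-cong e≅G f≅H)
    ; cw       = let (m , e , e≅G) = cw wG ; (n , f , f≅H) = cw wH in
                 m + n , union e f , ≅-trans (cwGraph-union e f) (glue-cong e≅G f≅H)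
    ; co-cw    = let (m , e , e≅G) = co-cw wG ; (n , f , f≅H) = co-cw wH in
                 m + n , cwJoin e f ,
                 ≅-trans (cwGraph-join e f) (≅-trans (glue-cong e≅G f≅H) (≅-sym (complement-glue false G H))) }

SmallWidth-bigUnion : ∀ k (Gs : Fin (suc k) → Graph) → (∀ i → SmallWidth (Gs i)) → SmallWidth (bigUnion (suc k) Gs)
SmallWidth-bigUnion zero    Gs ws = SmallWidth-≅ (ws zero) (≅-sym (⊕-identityʳ (Gs zero)))
SmallWidth-bigUnion (suc k) Gs ws = SmallWidth-⊕ (ws zero) (SmallWidth-bigUnion k (Gs ∘ suc) (ws ∘ suc))

SmallWidth-shape : ∀ t → SmallWidth (shapeGraph t)
SmallWidth-shape t = record
  { loopless = λ i → edge-irrefl t (to (enumerate t) i)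
  ; nlc      = ∣ t ∣ , nlcShape t , ≗⇒≅ (nlcAdj-nlcShape t)
  ; cw       = ∣ t ∣ , cwShape t , ≗⇒≅ (edges (realises-cwShape t))
  ; co-cw    = ∣ t ∣ , coCwShape t , ≗⇒≅ (edges (realises-coCwShape t)) }

SmallWidth-forest : ∀ {G} → IsSimple G → Acyclic G → 1 ≤ size G → SmallWidth G
SmallWidth-forest {mkGraph (suc n) a} simple acyclic (s≤s z≤n) =
  let (t , G≃t) = shapeOf n a simple acyclic in
  SmallWidth-≅ (SmallWidth-shape t) (≃-unique (shapeGraph≃edge t) G≃t)

SmallWidth-treeCograph : ∀ {G} → TreeCograph G → SmallWidth G
SmallWidth-treeCograph (tree (simple , (nonempty , _) , acyclic)) = SmallWidth-forest simple acyclic nonempty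
SmallWidth-treeCograph (compl tc)                                 = SmallWidth-complement (SmallWidth-treeCograph tc)
SmallWidth-treeCograph (union (suc k) _ Gs tcs _)                 = SmallWidth-bigUnion k Gs (SmallWidth-treeCograph ∘ tcs)
SmallWidth-treeCograph (iso tc φ)                                 = SmallWidth-≅ (SmallWidth-treeCograph tc) φ

corollary3 : ∀ (G : Graph) → TreeCograph G → NLCWidthAtMost 3 G × CliqueWidthAtMost 4 G
corollary3 G tc = (3 , s≤s z≤n , ≤-refl , nlc w) , (4 , s≤s z≤n , ≤-refl , cw w)
  where
  w : SmallWidth G
  w = SmallWidth-treeCograph tc
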